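{- Let $\pi$ be a pin-permutation of size $n$ written $\pi=\oplus[\pi_1,\dots,\pi_r]$ with $r\ge2$ and each $\pi_i$ $\oplus$-indecomposable, let $T_1,\dots,T_r$ be the corresponding sets of points of the diagram of $\pi$, let $p=(p_1,\dots,p_n)$ be a pin representation of $\pi$ and let $i_0$ be such that $p_1\in T_{i_0}$. Then every $T_i$ with $i\ne i_0$ is read in one piece by $p$.
   Context: For permutations $\pi_1,\dots,\pi_r$, $\oplus[\pi_1,\dots,\pi_r]$ is the permutation whose diagram consists of copies of the diagrams of $\pi_1,\dots,\pi_r$ placed in this order along an increasing diagonal (each copy entirely to the right of and above the previous one). A permutation is $\oplus$-indecomposable if it cannot be written as $\oplus[\tau_1,\dots,\tau_k]$ with $k\ge2$. A pin representation of $\pi$ is a sequence of points $(p_1,\dots,p_n)$, no two on a common horizontal or vertical line, order-isomorphic to the diagram of $\pi$ (identified with it), such that each $p_i$ ($i\ge2$) lies outside the bounding box (smallest axis-parallel rectangle) of $\{p_1,\dots,p_{i-1}\}$ and either separates $p_{i-1}$ from $\{p_1,\dots,p_{i-2}\}$ (the horizontal or vertical line through $p_i$ has them on opposite sides) or does not separate $\{p_1,\dots,p_{i-1}\}$ into two nonempty sets. A pin-permutation is one having a pin representation. A set $D$ of points is read in $k$ pieces by $p$ if there are exactly $k$ maximal factors $p_i,p_{i+1},\dots,p_{i+j}$ of $p$ consisting only of points of $D$; "read in one piece" means $k=1$. -}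

module Defs where

open import Data.Nat using (ℕ; zero; suc; _+_; _≤_; _<_)
open import Data.Fin using (Fin; toℕ; fromℕ<)
open import Data.List using (List; []; _∷_; _++_; map; length; lookup; foldr; take; upTo)
open import Data.Nat.ListAction using (sum)
open import Data.List.Relation.Unary.All using (All)
open import Data.List.Relation.Binary.Permutation.Propositional using (_↭_)
open import Data.Product using (Σ; ∃; _×_; _,_)
open import Data.Sum using (_⊎_)
open import Relation.Nullary using (¬_)
open import Relation.Binary.PropositionalEquality using (_≡_)
open import Function.Definitions using (Injective)

-- Permutations in one-line notation, values 0 … n-1.

IsPerm : List ℕ → Set
IsPerm xs = xs ↭ upTo (length xs)

_⊕_ : List ℕ → List ℕ → List ℕ
xs ⊕ ys = xs ++ map (length xs +_) ys

⊕[_] : List (List ℕ) → List ℕ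
⊕[ πs ] = foldr _⊕_ [] πs

IsNonemptyPerm : List ℕ → Set
IsNonemptyPerm τ = IsPerm τ × 1 ≤ length τ

⊕-Indecomposable : List ℕ → Set
⊕-Indecomposable π =
  IsNonemptyPerm π ×
  ¬ (Σ (List (List ℕ)) λ τs → 2 ≤ length τs × All IsNonemptyPerm τs × π ≡ ⊕[ τs ])

module Diagram (π : List ℕ) where

  N : ℕ
  N = length π

  Point : Set
  Point = Fin N

  X Y : Point → ℕ
  X j = toℕ j
  Y j = lookup π j

  PointSet : Set₁
  PointSet = Point → Set

  InBoundingBox : Point → PointSet → Set
  InBoundingBox z S =
    Σ Point λ a → Σ Point λ b → Σ Point λ c → Σ Point λ d →
      S a × S b × S c × S d ×
      X a ≤ X z × X z ≤ X b × Y c ≤ Y z × Y z ≤ Y d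

  HSeparates VSeparates : Point → Point → PointSet → Set
  HSeparates z q B =
    (Y q < Y z × (∀ b → B b → Y z < Y b)) ⊎ (Y z < Y q × (∀ b → B b → Y b < Y z))
  VSeparates z q B =
    (X q < X z × (∀ b → B b → X z < X b)) ⊎ (X z < X q × (∀ b → B b → X b < X z))

  Separates : Point → Point → PointSet → Set
  Separates z q B = HSeparates z q B ⊎ VSeparates z q B

  DoesNotSplit : Point → PointSet → Set
  DoesNotSplit z S =
    (¬ (Σ Point λ a → Σ Point λ b → S a × S b × Y a < Y z × Y z < Y b)) ×
    (¬ (Σ Point λ a → Σ Point λ b → S a × S b × X a < X z × X z < X b))

  -- A sequence p = (p_1,…,p_n) of the points of the diagram is encoded as
  -- p : Fin N → Point (position ↦ point), injective (so each point once).
  -- Positions are 0-indexed.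
  Sequence : Set
  Sequence = Fin N → Point

  Before : Sequence → ℕ → PointSet
  Before p m q = Σ (Fin N) λ k → toℕ k < m × p k ≡ q

  IsPinRepresentation : Sequence → Set
  IsPinRepresentation p =
    Injective _≡_ _≡_ p ×
    (∀ (m m′ : Fin N) → suc (toℕ m′) ≡ toℕ m →
       (¬ InBoundingBox (p m) (Before p (toℕ m))) ×
       (Separates (p m) (p m′) (Before p (toℕ m′)) ⊎
        DoesNotSplit (p m) (Before p (toℕ m))))

  MaximalFactor : Sequence → PointSet → ℕ → ℕ → Set
  MaximalFactor p D a b =
    a ≤ b × b < N ×
    (∀ k → a ≤ k → k ≤ b → (h : k < N) → D (p (fromℕ< h))) ×
    (∀ k → suc k ≡ a → (h : k < N) → ¬ D (p (fromℕ< h))) ×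
    ((h : suc b < N) → ¬ D (p (fromℕ< h)))

  ReadInOnePiece : Sequence → PointSet → Set
  ReadInOnePiece p D =
    Σ ℕ λ a → Σ ℕ λ b → MaximalFactor p D a b ×
      (∀ a′ b′ → MaximalFactor p D a′ b′ → a′ ≡ a × b′ ≡ b)

-- Blocks of π = ⊕[π₁,…,πᵣ]: T_i is the set of points of the copy of πᵢ,
-- i.e. the positions offset_i ≤ j < offset_i + |πᵢ|.

offset : (πs : List (List ℕ)) → Fin (length πs) → ℕ
offset πs i = sum (map length (take (toℕ i) πs))

InBlock : (πs : List (List ℕ)) → Fin (length πs) → {n : ℕ} → Fin n → Set
InBlock πs i j = offset πs i ≤ toℕ j × toℕ j < offset πs i + length (lookup πs i)

-- Suppose a block T_i (i ≠ i₀) is read in several pieces, so some p_v outside T_i is read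
-- between two points of T_i; say T_i lies above-right of T_{i₀}, hence of p_1 (the other case
-- is symmetric). A pin p_t of T_i read after p_v lies above-right of p_1 and outside the
-- bounding box of the earlier pins, and whichever pin rule it obeys forces it above-right of
-- every pin read before p_{t-1}, in particular of all points of T_i read before p_v. So the
-- points of T_i read before p_v lie below-left of those read after it, which exhibits π_i as
-- ⊕-decomposable. Hence the positions of T_i in p form an interval.

module Submission where

open import Defs
open import Data.Nat using (ℕ; zero; suc; _+_; _∸_; _≤_; _<_; z≤n; s≤s; _<?_; _≤?_; _≟_)
open import Data.Nat.Properties
open import Data.Nat.ListAction using (sum)
open import Data.Fin using (Fin; toℕ; fromℕ<; inject₁; punchOut) renaming (zero to fzero; suc to fsuc)
open import Data.Fin.Properties
  using (toℕ-injective; toℕ-fromℕ<; toℕ-inject₁; toℕ<n; any?; punchOut-injective; injective⇒≤)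
  renaming (_≟_ to _≟ᶠ_)
open import Data.List using (List; []; _∷_; _++_; map; length; lookup; take; drop; upTo; filter; _∷ʳ_)
open import Data.List.Properties
  using (length-++; length-map; length-upTo; map-++; ++-assoc; ++-identityʳ; upTo-∷ʳ; length-take;
         length-drop; take++drop≡id; map-∘; map-cong; map-id; map-id-local; filter-all; filter-none;
         filter-++; filter-notAll; filter-some)
open import Data.List.Relation.Unary.All as All using (All; []; _∷_; all?)
open import Data.List.Relation.Unary.All.Properties.Core using (¬All⇒Any¬)
open import Data.List.Relation.Unary.All.Properties using (map⁺)
import Data.List.Relation.Unary.Any as Any
open import Data.List.Relation.Unary.AllPairs using (_∷_)
open import Data.List.Relation.Unary.Unique.Propositional using (Unique)
import Data.List.Relation.Unary.Unique.Propositional.Properties as Unique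
open import Data.List.Membership.Propositional.Properties using (∈-upTo⁻; ∈-lookup)
open import Data.List.Relation.Binary.Permutation.Propositional using (_↭_; ↭-sym; ↭⇒↭ₛ)
open import Data.List.Relation.Binary.Permutation.Propositional.Properties
  using (↭-length; filter-↭; ∈-resp-↭)
import Data.List.Relation.Binary.Permutation.Propositional.Properties as Perm
import Data.List.Relation.Binary.Permutation.Setoid.Properties as SetoidPerm
open import Relation.Binary.PropositionalEquality.Properties using (setoid)
open import Data.Product using (Σ; ∃; _×_; _,_; proj₁; proj₂)
open import Data.Sum using (_⊎_; inj₁; inj₂; [_,_])
open import Data.Empty using (⊥-elim)
open import Relation.Nullary using (¬_; Dec; yes; no; ¬?)
open import Relation.Nullary.Decidable using (_×-dec_)
open import Relation.Binary.Definitions using (tri<; tri≈; tri>)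
open import Relation.Binary.PropositionalEquality
  using (_≡_; _≢_; refl; sym; trans; cong; cong₂; subst; subst₂; ≢-sym; module ≡-Reasoning)
open import Function using (id)
open import Function.Definitions using (Injective)

-- Out of range the value is 0; it is only ever read in range.
nth : List ℕ → ℕ → ℕ
nth []       _       = 0
nth (x ∷ xs) zero    = x
nth (x ∷ xs) (suc j) = nth xs j

lookup≡nth : ∀ xs (j : Fin (length xs)) → lookup xs j ≡ nth xs (toℕ j)
lookup≡nth (x ∷ xs) fzero    = refl
lookup≡nth (x ∷ xs) (fsuc j) = lookup≡nth xs j

nth-++ˡ : ∀ xs ys {j} → j < length xs → nth (xs ++ ys) j ≡ nth xs j
nth-++ˡ (x ∷ xs) ys {zero}  _       = refl
nth-++ˡ (x ∷ xs) ys {suc j} (s≤s h) = nth-++ˡ xs ys h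

nth-++ʳ : ∀ xs ys j → nth (xs ++ ys) (length xs + j) ≡ nth ys j
nth-++ʳ []       ys j = refl
nth-++ʳ (x ∷ xs) ys j = nth-++ʳ xs ys j

nth-map : ∀ (f : ℕ → ℕ) xs {j} → j < length xs → nth (map f xs) j ≡ f (nth xs j)
nth-map f (x ∷ xs) {zero}  _       = refl
nth-map f (x ∷ xs) {suc j} (s≤s h) = nth-map f xs h

nth-take : ∀ k xs {j} → j < k → nth (take k xs) j ≡ nth xs j
nth-take (suc k) []       h       = refl
nth-take (suc k) (x ∷ xs) {zero}  h       = refl
nth-take (suc k) (x ∷ xs) {suc j} (s≤s h) = nth-take k xs h

nth-drop : ∀ k xs j → nth (drop k xs) j ≡ nth xs (k + j)
nth-drop zero    xs       j = refl
nth-drop (suc k) []       j = refl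
nth-drop (suc k) (x ∷ xs) j = nth-drop k xs j

All⇒nth : ∀ {P : ℕ → Set} xs {j} → All P xs → j < length xs → P (nth xs j)
All⇒nth (x ∷ xs) {zero}  (px ∷ _)   _       = px
All⇒nth (x ∷ xs) {suc j} (_  ∷ pxs) (s≤s h) = All⇒nth xs pxs h

nth⇒All : ∀ {P : ℕ → Set} xs → (∀ j → j < length xs → P (nth xs j)) → All P xs
nth⇒All []       f = []
nth⇒All (x ∷ xs) f = f zero (s≤s z≤n) ∷ nth⇒All xs (λ j h → f (suc j) (s≤s h))

nth-injective : ∀ xs → Unique xs → ∀ {j j′} → j < length xs → j′ < length xs →
                nth xs j ≡ nth xs j′ → j ≡ j′
nth-injective (x ∷ xs) (x∉ ∷ u) {zero}  {zero}   _       _        _ = refl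
nth-injective (x ∷ xs) (x∉ ∷ u) {zero}  {suc j′} _       (s≤s h′) e = ⊥-elim (All⇒nth xs x∉ h′ e)
nth-injective (x ∷ xs) (x∉ ∷ u) {suc j} {zero}   (s≤s h) _        e = ⊥-elim (All⇒nth xs x∉ h (sym e))
nth-injective (x ∷ xs) (x∉ ∷ u) {suc j} {suc j′} (s≤s h) (s≤s h′) e = cong suc (nth-injective xs u h h′ e)

IsPerm⇒Unique : ∀ {τ} → IsPerm τ → Unique τ
IsPerm⇒Unique {τ} τ↭ =
  SetoidPerm.Unique-resp-↭ (setoid ℕ) (↭⇒↭ₛ (↭-sym τ↭)) (Unique.upTo⁺ (length τ))

IsPerm⇒nth< : ∀ {τ} → IsPerm τ → ∀ {j} → j < length τ → nth τ j < length τ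
IsPerm⇒nth< {τ} τ↭ h = ∈-upTo⁻ (∈-resp-↭ τ↭ (All⇒nth τ (All.tabulate id) h))

upTo-+ : ∀ k m → upTo (k + m) ≡ upTo k ++ map (k +_) (upTo m)
upTo-+ k zero = trans (cong upTo (+-identityʳ k)) (sym (++-identityʳ (upTo k)))
upTo-+ k (suc m) = begin
    upTo (k + suc m)                                    ≡⟨ cong upTo (+-suc k m) ⟩
    upTo (suc (k + m))                                  ≡⟨ sym (upTo-∷ʳ (k + m)) ⟩
    upTo (k + m) ∷ʳ (k + m)                             ≡⟨ cong (_∷ʳ (k + m)) (upTo-+ k m) ⟩
    (upTo k ++ map (k +_) (upTo m)) ++ (k + m ∷ [])     ≡⟨ ++-assoc (upTo k) _ _ ⟩
    upTo k ++ (map (k +_) (upTo m) ++ map (k +_) (m ∷ [])) ≡⟨ cong (upTo k ++_) (sym (map-++ (k +_) (upTo m) _)) ⟩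
    upTo k ++ map (k +_) (upTo m ∷ʳ m)                  ≡⟨ cong (λ z → upTo k ++ map (k +_) z) (upTo-∷ʳ m) ⟩
    upTo k ++ map (k +_) (upTo (suc m))                 ∎
  where open ≡-Reasoning

filter-<-upTo : ∀ k m → filter (_<? k) (upTo (k + m)) ≡ upTo k
filter-<-upTo k m = begin
    filter (_<? k) (upTo (k + m))
  ≡⟨ cong (filter (_<? k)) (upTo-+ k m) ⟩
    filter (_<? k) (upTo k ++ map (k +_) (upTo m))
  ≡⟨ filter-++ (_<? k) (upTo k) _ ⟩
    filter (_<? k) (upTo k) ++ filter (_<? k) (map (k +_) (upTo m))
  ≡⟨ cong₂ _++_ (filter-all (_<? k) (All.tabulate ∈-upTo⁻))
                (filter-none (_<? k) (map⁺ {xs = upTo m} (All.tabulate (λ {x} _ → m+n≮m k x)))) ⟩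
    upTo k ++ []
  ≡⟨ ++-identityʳ _ ⟩
    upTo k ∎
  where open ≡-Reasoning

filter-≥-upTo : ∀ k m → filter (k ≤?_) (upTo (k + m)) ≡ map (k +_) (upTo m)
filter-≥-upTo k m = begin
    filter (k ≤?_) (upTo (k + m))
  ≡⟨ cong (filter (k ≤?_)) (upTo-+ k m) ⟩
    filter (k ≤?_) (upTo k ++ map (k +_) (upTo m))
  ≡⟨ filter-++ (k ≤?_) (upTo k) _ ⟩
    filter (k ≤?_) (upTo k) ++ filter (k ≤?_) (map (k +_) (upTo m))
  ≡⟨ cong₂ _++_ (filter-none (k ≤?_) (All.tabulate (λ x∈ → <⇒≱ (∈-upTo⁻ x∈))))
                (filter-all (k ≤?_) (map⁺ {xs = upTo m} (All.tabulate (λ {x} _ → m≤m+n k x)))) ⟩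
    map (k +_) (upTo m) ∎
  where open ≡-Reasoning

-- ⊕-decompositions

⊕-Decomposable : List ℕ → Set
⊕-Decomposable τ = Σ (List (List ℕ)) λ τs → 2 ≤ length τs × All IsNonemptyPerm τs × τ ≡ ⊕[ τs ]

module _ {A D : List ℕ} (A++D↭ : A ++ D ↭ upTo (length A + length D))
         (A<D : All (λ a → All (a <_) D) A) where

  private
    k = length A
    m = length D

    count-below : length (filter (_<? k) (A ++ D)) ≡ k
    count-below = trans (↭-length (filter-↭ (_<? k) A++D↭))
                        (trans (cong length (filter-<-upTo k m)) (length-upTo k))

  -- In both halves, some value on the wrong side of k would make the count of values below k wrong.
  lower-half-< : All (_< length A) A
  lower-half-< with all? (_<? k) A
  ... | yes all< = all<
  ... | no ¬all< = ⊥-elim (<-irrefl count-below too-few)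
    where
    big = ¬All⇒Any¬ (_<? k) A ¬all<
    D-big : All (λ d → ¬ d < k) D
    D-big = let (a<D , a≮k) = All.lookupAny A<D big in All.map (λ a<d d<k → a≮k (<-trans a<d d<k)) a<D
    too-few : length (filter (_<? k) (A ++ D)) < k
    too-few = begin-strict
      length (filter (_<? k) (A ++ D))                    ≡⟨ cong length (filter-++ (_<? k) A D) ⟩
      length (filter (_<? k) A ++ filter (_<? k) D)
        ≡⟨ cong (λ ys → length (filter (_<? k) A ++ ys)) (filter-none (_<? k) D-big) ⟩
      length (filter (_<? k) A ++ [])                     ≡⟨ cong length (++-identityʳ (filter (_<? k) A)) ⟩
      length (filter (_<? k) A)                           <⟨ filter-notAll (_<? k) A big ⟩
      k                                                   ∎
      where open ≤-Reasoning

  upper-half-≥ : All (length A ≤_) D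
  upper-half-≥ with all? (k ≤?_) D
  ... | yes all≥ = all≥
  ... | no ¬all≥ = ⊥-elim (<-irrefl (sym count-below) too-many)
    where
    small = ¬All⇒Any¬ (k ≤?_) D ¬all≥
    A-small : All (_< k) A
    A-small = All.map (λ a<D → let (a<d , d≱k) = All.lookupAny a<D small in <-trans a<d (≰⇒> d≱k)) A<D
    too-many : k < length (filter (_<? k) (A ++ D))
    too-many = begin-strict
      k                                                   ≡⟨ sym (+-identityʳ k) ⟩
      k + 0                                               <⟨ +-monoʳ-< k (filter-some (_<? k) (Any.map ≰⇒> small)) ⟩
      k + length (filter (_<? k) D)
        ≡⟨ cong (λ xs → length xs + length (filter (_<? k) D)) (sym (filter-all (_<? k) A-small)) ⟩
      length (filter (_<? k) A) + length (filter (_<? k) D) ≡⟨ sym (length-++ (filter (_<? k) A)) ⟩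
      length (filter (_<? k) A ++ filter (_<? k) D)       ≡⟨ cong length (sym (filter-++ (_<? k) A D)) ⟩
      length (filter (_<? k) (A ++ D))                    ∎
      where open ≤-Reasoning

  lower-half-↭ : A ↭ upTo (length A)
  lower-half-↭ = subst₂ _↭_ filter-A (filter-<-upTo k m) (filter-↭ (_<? k) A++D↭)
    where
    filter-A : filter (_<? k) (A ++ D) ≡ A
    filter-A = begin
      filter (_<? k) (A ++ D)                ≡⟨ filter-++ (_<? k) A D ⟩
      filter (_<? k) A ++ filter (_<? k) D   ≡⟨ cong₂ _++_ (filter-all (_<? k) lower-half-<)
                                                           (filter-none (_<? k) (All.map (λ k≤d d<k → <⇒≱ d<k k≤d) upper-half-≥)) ⟩
      A ++ []                                ≡⟨ ++-identityʳ A ⟩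
      A                                      ∎
      where open ≡-Reasoning

  upper-half-↭ : D ↭ map (length A +_) (upTo (length D))
  upper-half-↭ = subst₂ _↭_ filter-D (filter-≥-upTo k m) (filter-↭ (k ≤?_) A++D↭)
    where
    filter-D : filter (k ≤?_) (A ++ D) ≡ D
    filter-D = trans (filter-++ (k ≤?_) A D)
                     (cong₂ _++_ (filter-none (k ≤?_) (All.map (λ a<k k≤a → <⇒≱ a<k k≤a) lower-half-<))
                                 (filter-all (k ≤?_) upper-half-≥))

  ++-⊕-decomposable : 1 ≤ length A → 1 ≤ length D → ⊕-Decomposable (A ++ D)
  ++-⊕-decomposable 1≤k 1≤m =
    A ∷ B ∷ [] , s≤s (s≤s z≤n) ,
    (lower-half-↭ , 1≤k) ∷ (B↭ , subst (1 ≤_) (sym |B|) 1≤m) ∷ [] ,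
    sym (cong (A ++_) (trans (cong (map (k +_)) (++-identityʳ B)) k+B≡D))
    where
    B = map (_∸ k) D
    |B| : length B ≡ m
    |B| = length-map (_∸ k) D
    B↭ : B ↭ upTo (length B)
    B↭ = subst₂ _↭_ refl shift-back (Perm.map⁺ (_∸ k) upper-half-↭)
      where
      shift-back : map (_∸ k) (map (k +_) (upTo m)) ≡ upTo (length B)
      shift-back = trans (sym (map-∘ (upTo m)))
                         (trans (map-cong (m+n∸m≡n k) (upTo m)) (trans (map-id (upTo m)) (cong upTo (sym |B|))))
    k+B≡D : map (k +_) B ≡ D
    k+B≡D = trans (sym (map-∘ D)) (map-id-local (All.map m+[n∸m]≡n upper-half-≥))

prefix-below⇒⊕-decomposable :
  ∀ τ → IsPerm τ → ∀ k → 0 < k → k < length τ →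
  (∀ j j′ → j < k → k ≤ j′ → j′ < length τ → nth τ j < nth τ j′) → ⊕-Decomposable τ
prefix-below⇒⊕-decomposable τ τ↭ k 0<k k<n below =
  subst ⊕-Decomposable (take++drop≡id k τ)
    (++-⊕-decomposable A++D↭ A<D (subst (1 ≤_) (sym |A|) 0<k) (subst (1 ≤_) (sym |D|) (m<n⇒0<n∸m k<n)))
  where
  A = take k τ
  D = drop k τ
  |A| : length A ≡ k
  |A| = trans (length-take k τ) (m≤n⇒m⊓n≡m (<⇒≤ k<n))
  |D| : length D ≡ length τ ∸ k
  |D| = length-drop k τ
  A++D↭ : A ++ D ↭ upTo (length A + length D)
  A++D↭ = subst (λ n → A ++ D ↭ upTo n) (length-++ A)
            (subst (λ xs → xs ↭ upTo (length xs)) (sym (take++drop≡id k τ)) τ↭)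
  A<D : All (λ a → All (a <_) D) A
  A<D = nth⇒All A λ j j<|A| → nth⇒All D λ j′ j′<|D| →
    let j<k = subst (j <_) |A| j<|A| in
    subst₂ _<_ (sym (nth-take k τ j<k)) (sym (nth-drop k τ j′))
      (below j (k + j′) j<k (m≤m+n k j′)
        (subst (k + j′ <_) (m+[n∸m]≡n (<⇒≤ k<n)) (+-monoʳ-< k (subst (j′ <_) |D| j′<|D|))))

module _ {S : ℕ → Set} (S? : ∀ k → Dec (S k)) where

  private
    least? : ∀ n → (∀ j → j < n → ¬ S j) ⊎ (∃ λ a → a < n × S a × (∀ k → k < a → ¬ S k))
    least? zero = inj₁ (λ _ ())
    least? (suc n) with least? n
    ... | inj₂ (a , a<n , Sa , minimal) = inj₂ (a , m<n⇒m<1+n a<n , Sa , minimal)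
    ... | inj₁ none with S? n
    ...   | yes Sn = inj₂ (n , ≤-refl , Sn , none)
    ...   | no ¬Sn = inj₁ λ j j<1+n → [ none j , (λ { refl → ¬Sn }) ] (m<1+n⇒m<n∨m≡n j<1+n)

    greatest? : ∀ n → (∀ j → j < n → ¬ S j) ⊎ (∃ λ b → b < n × S b × (∀ k → b < k → k < n → ¬ S k))
    greatest? zero = inj₁ (λ _ ())
    greatest? (suc n) with S? n
    ... | yes Sn = inj₂ (n , ≤-refl , Sn , λ k n<k k<1+n → ⊥-elim (<⇒≱ n<k (≤-pred k<1+n)))
    ... | no ¬Sn with greatest? n
    ...   | inj₁ none = inj₁ λ j j<1+n → [ none j , (λ { refl → ¬Sn }) ] (m<1+n⇒m<n∨m≡n j<1+n)
    ...   | inj₂ (b , b<n , Sb , maximal) = inj₂ (b , m<n⇒m<1+n b<n , Sb ,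
              λ k b<k k<1+n → [ maximal k b<k , (λ { refl → ¬Sn }) ] (m<1+n⇒m<n∨m≡n k<1+n))

  least : ∀ {n j} → j < n → S j → ∃ λ a → a < n × S a × (∀ k → k < a → ¬ S k)
  least {n} {j} j<n Sj = [ (λ none → ⊥-elim (none j j<n Sj)) , id ] (least? n)

  greatest : ∀ {n j} → j < n → S j → ∃ λ b → b < n × S b × (∀ k → b < k → k < n → ¬ S k)
  greatest {n} {j} j<n Sj = [ (λ none → ⊥-elim (none j j<n Sj)) , id ] (greatest? n)

-- The positions in E form an initial segment [0, k), cut off at the least position outside E.
lower-left-set⇒⊕-decomposable :
  ∀ τ → IsPerm τ → (E : ℕ → Set) → (∀ j → Dec (E j)) →
  (∀ j j′ → j < length τ → j′ < length τ → E j → ¬ E j′ → j < j′ × nth τ j < nth τ j′) →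
  ∀ {j₁ j₂} → j₁ < length τ → E j₁ → j₂ < length τ → ¬ E j₂ → ⊕-Decomposable τ
lower-left-set⇒⊕-decomposable τ τ↭ E E? ordered {j₁} {j₂} j₁<L Ej₁ j₂<L ¬Ej₂ =
  prefix-below⇒⊕-decomposable τ τ↭ k 0<k k<L below
  where
  cut = least (λ j → ¬? (E? j)) (n<1+n j₂) ¬Ej₂
  k = proj₁ cut
  k<L : k < length τ
  k<L = ≤-<-trans (≤-pred (proj₁ (proj₂ cut))) j₂<L
  ¬Ek = proj₁ (proj₂ (proj₂ cut))
  0<k : 0 < k
  0<k = ≤-<-trans z≤n (proj₁ (ordered j₁ k j₁<L k<L Ej₁ ¬Ek))
  E-below : ∀ {j} → j < k → E j
  E-below {j} j<k with E? j
  ... | yes Ej = Ej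
  ... | no ¬Ej = ⊥-elim (proj₂ (proj₂ (proj₂ cut)) j j<k ¬Ej)
  below : ∀ j j′ → j < k → k ≤ j′ → j′ < length τ → nth τ j < nth τ j′
  below j j′ j<k k≤j′ j′<L with E? j′
  ... | yes Ej′ = ⊥-elim (<⇒≱ (proj₁ (ordered j′ k j′<L k<L Ej′ ¬Ek)) k≤j′)
  ... | no ¬Ej′ = proj₂ (ordered j j′ (<-trans j<k k<L) j′<L (E-below j<k) ¬Ej′)

injective⇒surjective : ∀ {n} (f : Fin n → Fin n) → Injective _≡_ _≡_ f → ∀ y → ∃ λ x → f x ≡ y
injective⇒surjective {suc n} f f-injective y with any? (λ x → f x ≟ᶠ y)
... | yes hit = hit
... | no miss = ⊥-elim (1+n≰n (injective⇒≤ g-injective))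
  where
  y≢f : ∀ x → y ≢ f x
  y≢f x e = miss (x , sym e)
  g : Fin (suc n) → Fin n
  g x = punchOut (y≢f x)
  g-injective : Injective _≡_ _≡_ g
  g-injective {a} {b} e = f-injective (punchOut-injective (y≢f a) (y≢f b) e)

predecessor : ∀ {n v} (t : Fin n) → v < toℕ t → ∃ λ (t′ : Fin n) → suc (toℕ t′) ≡ toℕ t × v ≤ toℕ t′
predecessor {v = v} (fsuc t′) (s≤s v≤t′) =
  inject₁ t′ , cong suc (toℕ-inject₁ t′) , subst (v ≤_) (sym (toℕ-inject₁ t′)) v≤t′

-- Diagrams and pin representations

module Geometry (π : List ℕ) where

  open Diagram π public

  _◁_ : Point → Point → Set
  d ◁ d′ = X d < X d′ × Y d < Y d′

  module _ {p : Sequence} (pin : IsPinRepresentation p) {f u t′ t : Point}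
           (f≡0 : toℕ f ≡ 0) (u<t′ : toℕ u < toℕ t′) (t′+1≡t : suc (toℕ t′) ≡ toℕ t)
           (Yu≢Yt : Y (p u) ≢ Y (p t)) where

    private
      t′<t : toℕ t′ < toℕ t
      t′<t = subst (toℕ t′ <_) t′+1≡t ≤-refl
      f<t′ : toℕ f < toℕ t′
      f<t′ = subst (_< toℕ t′) (sym f≡0) (≤-<-trans z≤n u<t′)
      f∈ : Before p (toℕ t′) (p f)
      f∈ = f , f<t′ , refl
      u∈ : Before p (toℕ t′) (p u)
      u∈ = u , u<t′ , refl
      f∈′ : Before p (toℕ t) (p f)
      f∈′ = f , <-trans f<t′ t′<t , refl
      u∈′ : Before p (toℕ t) (p u)
      u∈′ = u , <-trans u<t′ t′<t , refl
      t′∈′ : Before p (toℕ t) (p t′)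
      t′∈′ = t′ , t′<t , refl
      Xu≢Xt : X (p u) ≢ X (p t)
      Xu≢Xt e = <⇒≢ (<-trans u<t′ t′<t) (cong toℕ (proj₁ pin (toℕ-injective e)))
      outside = proj₁ (proj₂ pin t t′ t′+1≡t)
      pin-rule = proj₂ (proj₂ pin t t′ t′+1≡t)

    -- Separating p_{t-1} on the side away from p_1 keeps every earlier pin on p_1's side; the
    -- other coordinate is then forced because p_t lies outside the bounding box.
    pin-above-right-of-first : p f ◁ p t → p u ◁ p t
    pin-above-right-of-first (x₀<x , y₀<y) with pin-rule
    ... | inj₁ (inj₁ (inj₁ (_ , above))) = ⊥-elim (<-asym y₀<y (above (p f) f∈))
    ... | inj₁ (inj₁ (inj₂ (y<yq , below))) =
      ≰⇒> (λ x≤xu → outside (p f , p u , p f , p t′ , f∈′ , u∈′ , f∈′ , t′∈′ ,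
                              <⇒≤ x₀<x , x≤xu , <⇒≤ y₀<y , <⇒≤ y<yq)) ,
      below (p u) u∈
    ... | inj₁ (inj₂ (inj₁ (_ , right))) = ⊥-elim (<-asym x₀<x (right (p f) f∈))
    ... | inj₁ (inj₂ (inj₂ (x<xq , left))) =
      left (p u) u∈ ,
      ≰⇒> (λ y≤yu → outside (p f , p t′ , p f , p u , f∈′ , t′∈′ , f∈′ , u∈′ ,
                              <⇒≤ x₀<x , <⇒≤ x<xq , <⇒≤ y₀<y , y≤yu))
    ... | inj₂ (no-row , no-column) =
      ≤∧≢⇒< (≮⇒≥ λ x<xu → no-column (p f , p u , f∈′ , u∈′ , x₀<x , x<xu)) Xu≢Xt ,
      ≤∧≢⇒< (≮⇒≥ λ y<yu → no-row (p f , p u , f∈′ , u∈′ , y₀<y , y<yu)) Yu≢Yt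

    pin-below-left-of-first : p t ◁ p f → p t ◁ p u
    pin-below-left-of-first (x<x₀ , y<y₀) with pin-rule
    ... | inj₁ (inj₁ (inj₁ (yq<y , above))) =
      ≰⇒> (λ xu≤x → outside (p u , p f , p t′ , p f , u∈′ , f∈′ , t′∈′ , f∈′ ,
                              xu≤x , <⇒≤ x<x₀ , <⇒≤ yq<y , <⇒≤ y<y₀)) ,
      above (p u) u∈
    ... | inj₁ (inj₁ (inj₂ (_ , below))) = ⊥-elim (<-asym y<y₀ (below (p f) f∈))
    ... | inj₁ (inj₂ (inj₁ (xq<x , right))) =
      right (p u) u∈ ,
      ≰⇒> (λ yu≤y → outside (p t′ , p f , p u , p f , t′∈′ , f∈′ , u∈′ , f∈′ ,
                              <⇒≤ xq<x , <⇒≤ x<x₀ , yu≤y , <⇒≤ y<y₀))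
    ... | inj₁ (inj₂ (inj₂ (_ , left))) = ⊥-elim (<-asym x<x₀ (left (p f) f∈))
    ... | inj₂ (no-row , no-column) =
      ≤∧≢⇒< (≮⇒≥ λ xu<x → no-column (p u , p f , u∈′ , f∈′ , xu<x , x<x₀)) (≢-sym Xu≢Xt) ,
      ≤∧≢⇒< (≮⇒≥ λ yu<y → no-row (p u , p f , u∈′ , f∈′ , yu<y , y<y₀)) (≢-sym Yu≢Yt)

  module _ (p : Sequence) {D : PointSet} where

    -- Vacuous past the last position, as are the clauses of MaximalFactor.
    ReadAt : ℕ → Set
    ReadAt j = (h : j < N) → D (p (fromℕ< h))

    ReadAt? : (∀ d → Dec (D d)) → ∀ j → Dec (ReadAt j)
    ReadAt? D? j with j <? N
    ... | no j≮N = yes (λ h → ⊥-elim (j≮N h))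
    ... | yes j<N with D? (p (fromℕ< j<N))
    ...   | yes Dj = yes (λ _ → Dj)
    ...   | no ¬Dj = no (λ Dj → ¬Dj (Dj j<N))

    module _ (convex : ∀ u v w → toℕ u < toℕ v → toℕ v < toℕ w → D (p u) → D (p w) → D (p v)) where

      ReadAt-between : ∀ {u v w} → u ≤ v → v ≤ w → w < N → ReadAt u → ReadAt w → ReadAt v
      ReadAt-between u≤v v≤w w<N Du Dw v<N with m≤n⇒m<n∨m≡n u≤v | m≤n⇒m<n∨m≡n v≤w
      ... | inj₂ refl | _         = Du v<N
      ... | _         | inj₂ refl = Dw v<N
      ... | inj₁ u<v  | inj₁ v<w  =
        convex (fromℕ< u<N) (fromℕ< v<N) (fromℕ< w<N)
          (subst₂ _<_ (sym (toℕ-fromℕ< u<N)) (sym (toℕ-fromℕ< v<N)) u<v)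
          (subst₂ _<_ (sym (toℕ-fromℕ< v<N)) (sym (toℕ-fromℕ< w<N)) v<w)
          (Du u<N) (Dw w<N)
        where u<N = <-trans u<v (<-trans v<w w<N)

      convex⇒ReadInOnePiece : (∀ d → Dec (D d)) → (∃ λ k → D (p k)) → ReadInOnePiece p D
      convex⇒ReadInOnePiece D? (k , Dk) =
        a , b , (a≤b , b<N , (λ j a≤j j≤b → ReadAt-between a≤j j≤b b<N Da Db) , left-end , right-end) , unique
        where
        Dk′ : ReadAt (toℕ k)
        Dk′ h = subst D (cong p (toℕ-injective (sym (toℕ-fromℕ< h)))) Dk
        first = least (ReadAt? D?) (toℕ<n k) Dk′
        last = greatest (ReadAt? D?) (toℕ<n k) Dk′
        a = proj₁ first
        Da = proj₁ (proj₂ (proj₂ first))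
        before-a = proj₂ (proj₂ (proj₂ first))
        b = proj₁ last
        b<N = proj₁ (proj₂ last)
        Db = proj₁ (proj₂ (proj₂ last))
        after-b = proj₂ (proj₂ (proj₂ last))
        a≤b : a ≤ b
        a≤b = ≮⇒≥ (λ b<a → before-a b b<a Db)
        left-end : ∀ j → suc j ≡ a → (h : j < N) → ¬ D (p (fromℕ< h))
        left-end j j+1≡a h Dj = before-a j (subst (suc j ≤_) j+1≡a ≤-refl) (λ _ → Dj)
        right-end : (h : suc b < N) → ¬ D (p (fromℕ< h))
        right-end h Db+1 = after-b (suc b) ≤-refl h (λ _ → Db+1)
        gap-after-a : ∀ {x} → a < x → x < N → ReadAt x → ∃ λ j → suc j ≡ x × j < N × ReadAt j
        gap-after-a {suc j} (s≤s a≤j) j+1<N Dj+1 =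
          j , refl , <-trans (n<1+n j) j+1<N , ReadAt-between a≤j (n≤1+n j) j+1<N Da Dj+1
        unique : ∀ a′ b′ → MaximalFactor p D a′ b′ → a′ ≡ a × b′ ≡ b
        unique a′ b′ (a′≤b′ , b′<N , inside , left-end′ , right-end′) =
          ≤-antisym (≮⇒≥ a≮a′) (≮⇒≥ (λ a′<a → before-a a′ a′<a Da′)) ,
          ≤-antisym (≮⇒≥ (λ b<b′ → after-b b′ b<b′ b′<N Db′)) (≮⇒≥ b′≮b)
          where
          Da′ = inside a′ ≤-refl a′≤b′
          Db′ = inside b′ a′≤b′ ≤-refl
          a≮a′ : ¬ a < a′
          a≮a′ a<a′ with gap-after-a a<a′ (≤-<-trans a′≤b′ b′<N) Da′
          ... | j , j+1≡a′ , j<N , Dj = left-end′ j j+1≡a′ j<N (Dj j<N)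
          b′≮b : ¬ b′ < b
          b′≮b b′<b = right-end′ b′+1<N (ReadAt-between (n≤1+n b′) b′<b b<N Db′ Db b′+1<N)
            where b′+1<N = ≤-<-trans b′<b b<N

-- The blocks of ⊕[ πs ]

length-⊕[] : ∀ πs → length ⊕[ πs ] ≡ sum (map length πs)
length-⊕[] []       = refl
length-⊕[] (τ ∷ τs) =
  trans (length-++ τ) (cong (length τ +_) (trans (length-map (length τ +_) ⊕[ τs ]) (length-⊕[] τs)))

offset+length≤sum : ∀ πs (i : Fin (length πs)) → offset πs i + length (lookup πs i) ≤ sum (map length πs)
offset+length≤sum (τ ∷ τs) fzero    = m≤m+n (length τ) _
offset+length≤sum (τ ∷ τs) (fsuc i) =
  subst (_≤ length τ + sum (map length τs)) (sym (+-assoc (length τ) (offset τs i) _))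
    (+-monoʳ-≤ (length τ) (offset+length≤sum τs i))

offset+length≤offset : ∀ πs (i i′ : Fin (length πs)) → toℕ i < toℕ i′ →
                       offset πs i + length (lookup πs i) ≤ offset πs i′
offset+length≤offset (τ ∷ τs) fzero    (fsuc i′) _       = m≤m+n (length τ) _
offset+length≤offset (τ ∷ τs) (fsuc i) (fsuc i′) (s≤s h) =
  subst (_≤ length τ + offset τs i′) (sym (+-assoc (length τ) (offset τs i) _))
    (+-monoʳ-≤ (length τ) (offset+length≤offset τs i i′ h))

nth-⊕[] : ∀ πs (i : Fin (length πs)) {j} → j < length (lookup πs i) →
          nth ⊕[ πs ] (offset πs i + j) ≡ offset πs i + nth (lookup πs i) j
nth-⊕[] (τ ∷ τs) fzero    h = nth-++ˡ τ _ h
nth-⊕[] (τ ∷ τs) (fsuc i) {j} h = begin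
    nth (τ ++ map (length τ +_) ⊕[ τs ]) ((length τ + o) + j)
  ≡⟨ cong (nth (τ ++ map (length τ +_) ⊕[ τs ])) (+-assoc (length τ) o j) ⟩
    nth (τ ++ map (length τ +_) ⊕[ τs ]) (length τ + (o + j))
  ≡⟨ nth-++ʳ τ _ (o + j) ⟩
    nth (map (length τ +_) ⊕[ τs ]) (o + j)
  ≡⟨ nth-map (length τ +_) ⊕[ τs ] o+j<N ⟩
    length τ + nth ⊕[ τs ] (o + j)
  ≡⟨ cong (length τ +_) (nth-⊕[] τs i h) ⟩
    length τ + (o + nth (lookup τs i) j)
  ≡⟨ sym (+-assoc (length τ) o _) ⟩
    (length τ + o) + nth (lookup τs i) j ∎
  where
  open ≡-Reasoning
  o = offset τs i
  o+j<N : o + j < length ⊕[ τs ]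
  o+j<N = subst (o + j <_) (sym (length-⊕[] τs))
            (<-≤-trans (+-monoʳ-< o h) (offset+length≤sum τs i))

module Blocks (πs : List (List ℕ)) where

  open Geometry ⊕[ πs ]

  module Block (i : Fin (length πs)) where

    τ = lookup πs i
    o = offset πs i
    L = length τ

    local : Point → ℕ
    local d = X d ∸ o

    o+L≤N : o + L ≤ N
    o+L≤N = subst (o + L ≤_) (sym (length-⊕[] πs)) (offset+length≤sum πs i)

    InBlock? : ∀ d → Dec (InBlock πs i d)
    InBlock? d = (o ≤? X d) ×-dec (X d <? o + L)

    InBlock-column : ∀ {d j} → X d ≡ o + j → j < L → InBlock πs i d
    InBlock-column {j = j} Xd j<L =
      subst (o ≤_) (sym Xd) (m≤m+n o j) , subst (_< o + L) (sym Xd) (+-monoʳ-< o j<L)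

    X≡o+local : ∀ {d} → InBlock πs i d → X d ≡ o + local d
    X≡o+local (o≤X , _) = sym (m+[n∸m]≡n o≤X)

    local<L : ∀ {d} → InBlock πs i d → local d < L
    local<L {d} d∈@(_ , X<o+L) = +-cancelˡ-< o _ _ (subst (_< o + L) (X≡o+local d∈) X<o+L)

    Y-column : ∀ {d j} → X d ≡ o + j → j < L → Y d ≡ o + nth τ j
    Y-column {d} {j} Xd j<L = begin
      lookup ⊕[ πs ] d    ≡⟨ lookup≡nth ⊕[ πs ] d ⟩
      nth ⊕[ πs ] (X d)   ≡⟨ cong (nth ⊕[ πs ]) Xd ⟩
      nth ⊕[ πs ] (o + j) ≡⟨ nth-⊕[] πs i j<L ⟩
      o + nth τ j         ∎
      where open ≡-Reasoning

    Y≡o+nth : ∀ {d} → InBlock πs i d → Y d ≡ o + nth τ (local d)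
    Y≡o+nth d∈ = Y-column (X≡o+local d∈) (local<L d∈)

    Y<o+L : IsPerm τ → ∀ {d} → InBlock πs i d → Y d < o + L
    Y<o+L τ↭ d∈ = subst (_< o + L) (sym (Y≡o+nth d∈)) (+-monoʳ-< o (IsPerm⇒nth< τ↭ (local<L d∈)))

    o≤Y : ∀ {d} → InBlock πs i d → o ≤ Y d
    o≤Y d∈ = subst (o ≤_) (sym (Y≡o+nth d∈)) (m≤m+n o _)

    Y-injective : IsPerm τ → ∀ {d d′} → InBlock πs i d → InBlock πs i d′ → Y d ≡ Y d′ → d ≡ d′
    Y-injective τ↭ d∈ d′∈ Yd≡Yd′ = toℕ-injective (begin
      X _           ≡⟨ X≡o+local d∈ ⟩
      o + local _   ≡⟨ cong (o +_) local≡ ⟩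
      o + local _   ≡⟨ sym (X≡o+local d′∈) ⟩
      X _           ∎)
      where
      open ≡-Reasoning
      local≡ = nth-injective τ (IsPerm⇒Unique τ↭) (local<L d∈) (local<L d′∈)
                 (+-cancelˡ-≡ o _ _ (trans (sym (Y≡o+nth d∈)) (trans Yd≡Yd′ (Y≡o+nth d′∈))))

    column : ∀ j → j < L → Point
    column j j<L = fromℕ< (<-≤-trans (+-monoʳ-< o j<L) o+L≤N)

    X-column : ∀ {j} (j<L : j < L) → X (column j j<L) ≡ o + j
    X-column j<L = toℕ-fromℕ< (<-≤-trans (+-monoʳ-< o j<L) o+L≤N)

    lower-left-part⇒⊕-decomposable :
      IsPerm τ → (P : PointSet) → (∀ d → Dec (P d)) →
      (∀ {d d′} → InBlock πs i d → InBlock πs i d′ → P d → ¬ P d′ → d ◁ d′) →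
      ∀ {d₁ d₂} → InBlock πs i d₁ → P d₁ → InBlock πs i d₂ → ¬ P d₂ → ⊕-Decomposable τ
    lower-left-part⇒⊕-decomposable τ↭ P P? P◁¬P {d₁} {d₂} d₁∈ Pd₁ d₂∈ ¬Pd₂ =
      lower-left-set⇒⊕-decomposable τ τ↭ E E? ordered
        (local<L d₁∈) (d₁ , X≡o+local d₁∈ , Pd₁) (local<L d₂∈) ¬Ed₂
      where
      E : ℕ → Set
      E j = Σ Point λ d → X d ≡ o + j × P d
      E? : ∀ j → Dec (E j)
      E? j = any? λ d → (X d ≟ o + j) ×-dec P? d
      ordered : ∀ j j′ → j < L → j′ < L → E j → ¬ E j′ → j < j′ × nth τ j < nth τ j′
      ordered j j′ j<L j′<L (d , Xd , Pd) ¬Ej′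
        with P◁¬P (InBlock-column Xd j<L) (InBlock-column Xd′ j′<L) Pd ¬Pd′
        where
        Xd′ = X-column j′<L
        ¬Pd′ = λ Pd′ → ¬Ej′ (column j′ j′<L , Xd′ , Pd′)
      ... | Xd<Xd′ , Yd<Yd′ =
        +-cancelˡ-< o _ _ (subst₂ _<_ Xd (X-column j′<L) Xd<Xd′) ,
        +-cancelˡ-< o _ _ (subst₂ _<_ (Y-column Xd j<L) (Y-column (X-column j′<L) j′<L) Yd<Yd′)
      ¬Ed₂ : ¬ E (local d₂)
      ¬Ed₂ (d , Xd , Pd) = ¬Pd₂ (subst P (toℕ-injective (trans Xd (sym (X≡o+local d₂∈)))) Pd)

  open Block

  earlier-block-◁ : ∀ {i₁ i₂ d₁ d₂} → IsPerm (lookup πs i₁) → toℕ i₁ < toℕ i₂ →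
                    InBlock πs i₁ d₁ → InBlock πs i₂ d₂ → d₁ ◁ d₂
  earlier-block-◁ {i₁} {i₂} τ↭ i₁<i₂ d₁∈ d₂∈ =
    <-≤-trans (proj₂ d₁∈) (≤-trans gap (proj₁ d₂∈)) ,
    <-≤-trans (Y<o+L i₁ τ↭ d₁∈) (≤-trans gap (o≤Y i₂ d₂∈))
    where gap = offset+length≤offset πs i₁ i₂ i₁<i₂

-- Blocks of a pin representation

module _ {πs : List (List ℕ)} (indecomposable : All ⊕-Indecomposable πs)
         {p : Diagram.Sequence ⊕[ πs ]} (pin : Diagram.IsPinRepresentation ⊕[ πs ] p)
         {i₀ : Fin (length πs)}
         (first∈i₀ : ∀ (k : Fin (length ⊕[ πs ])) → toℕ k ≡ 0 → InBlock πs i₀ (p k))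
         {i : Fin (length πs)} where

  open Geometry ⊕[ πs ]
  open Blocks πs
  open Block i

  private
    τ-indecomposable : ⊕-Indecomposable τ
    τ-indecomposable = All.lookup indecomposable (∈-lookup i)
    τ↭ : IsPerm τ
    τ↭ = proj₁ (proj₁ τ-indecomposable)
    i₀↭ : IsPerm (lookup πs i₀)
    i₀↭ = proj₁ (proj₁ (All.lookup indecomposable (∈-lookup i₀)))

  position : Point → Point
  position d = proj₁ (injective⇒surjective p (proj₁ pin) d)

  p∘position : ∀ d → p (position d) ≡ d
  p∘position d = proj₂ (injective⇒surjective p (proj₁ pin) d)

  module _ (v : Point) (v∉ : ¬ InBlock πs i (p v)) where

    ReadBefore ReadAfter : PointSet
    ReadBefore d = Σ Point λ m → p m ≡ d × toℕ m < toℕ v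
    ReadAfter d = Σ Point λ m → p m ≡ d × toℕ v < toℕ m

    ReadBefore? : ∀ d → Dec (ReadBefore d)
    ReadBefore? d = any? λ m → (p m ≟ᶠ d) ×-dec (toℕ m <? toℕ v)

    ReadAfter? : ∀ d → Dec (ReadAfter d)
    ReadAfter? d = any? λ m → (p m ≟ᶠ d) ×-dec (toℕ v <? toℕ m)

    read-before-or-after : ∀ {d} → InBlock πs i d → ReadBefore d ⊎ ReadAfter d
    read-before-or-after {d} d∈ with <-cmp (toℕ (position d)) (toℕ v)
    ... | tri< m<v _ _ = inj₁ (position d , p∘position d , m<v)
    ... | tri> _ _ v<m = inj₂ (position d , p∘position d , v<m)
    ... | tri≈ _ m≡v _ =
      ⊥-elim (v∉ (subst (InBlock πs i) (trans (sym (p∘position d)) (cong p (toℕ-injective m≡v))) d∈))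

    private
      first : Point
      first = fromℕ< (≤-<-trans z≤n (toℕ<n v))
      first≡0 : toℕ first ≡ 0
      first≡0 = toℕ-fromℕ< (≤-<-trans z≤n (toℕ<n v))
      Y≢ : ∀ {m m′} → InBlock πs i (p m) → InBlock πs i (p m′) → toℕ m < toℕ m′ → Y (p m) ≢ Y (p m′)
      Y≢ m∈ m′∈ m<m′ e = <⇒≢ m<m′ (cong toℕ (proj₁ pin (Y-injective τ↭ m∈ m′∈ e)))

    read-before-◁-read-after : toℕ i₀ < toℕ i → ∀ {d d′} → InBlock πs i d → InBlock πs i d′ →
                               ReadBefore d → ¬ ReadBefore d′ → d ◁ d′
    read-before-◁-read-after i₀<i d∈ d′∈ (m , refl , m<v) ¬before with read-before-or-after d′∈
    ... | inj₁ before = ⊥-elim (¬before before)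
    ... | inj₂ (m′ , refl , v<m′) =
      let (t′ , t′+1≡m′ , v≤t′) = predecessor m′ v<m′ in
      pin-above-right-of-first pin first≡0 (<-≤-trans m<v v≤t′) t′+1≡m′ (Y≢ d∈ d′∈ (<-trans m<v v<m′))
        (earlier-block-◁ i₀↭ i₀<i (first∈i₀ first first≡0) d′∈)

    read-after-◁-read-before : toℕ i < toℕ i₀ → ∀ {d d′} → InBlock πs i d → InBlock πs i d′ →
                               ReadAfter d → ¬ ReadAfter d′ → d ◁ d′
    read-after-◁-read-before i<i₀ d∈ d′∈ (m , refl , v<m) ¬after with read-before-or-after d′∈
    ... | inj₂ after = ⊥-elim (¬after after)
    ... | inj₁ (m′ , refl , m′<v) =
      let (t′ , t′+1≡m , v≤t′) = predecessor m v<m in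
      pin-below-left-of-first pin first≡0 (<-≤-trans m′<v v≤t′) t′+1≡m (Y≢ d′∈ d∈ (<-trans m′<v v<m))
        (earlier-block-◁ τ↭ i<i₀ d∈ (first∈i₀ first first≡0))

    split-at-v⇒⊕-decomposable : i ≢ i₀ → ∀ {u w} → toℕ u < toℕ v → toℕ v < toℕ w →
                                InBlock πs i (p u) → InBlock πs i (p w) → ⊕-Decomposable τ
    split-at-v⇒⊕-decomposable i≢i₀ {u} {w} u<v v<w u∈ w∈ with <-cmp (toℕ i₀) (toℕ i)
    ... | tri≈ _ i₀≡i _ = ⊥-elim (i≢i₀ (toℕ-injective (sym i₀≡i)))
    ... | tri< i₀<i _ _ =
      lower-left-part⇒⊕-decomposable τ↭ ReadBefore ReadBefore? (read-before-◁-read-after i₀<i)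
        u∈ (u , refl , u<v) w∈
        λ { (m , pm≡pw , m<v) → <-asym v<w (subst (λ x → toℕ x < toℕ v) (proj₁ pin pm≡pw) m<v) }
    ... | tri> _ _ i<i₀ =
      lower-left-part⇒⊕-decomposable τ↭ ReadAfter ReadAfter? (read-after-◁-read-before i<i₀)
        w∈ (w , refl , v<w) u∈
        λ { (m , pm≡pu , v<m) → <-asym u<v (subst (λ x → toℕ v < toℕ x) (proj₁ pin pm≡pu) v<m) }

  block-convex : i ≢ i₀ → ∀ u v w → toℕ u < toℕ v → toℕ v < toℕ w →
                 InBlock πs i (p u) → InBlock πs i (p w) → InBlock πs i (p v)
  block-convex i≢i₀ u v w u<v v<w u∈ w∈ with InBlock? (p v)
  ... | yes v∈ = v∈
  ... | no v∉ = ⊥-elim (proj₂ τ-indecomposable (split-at-v⇒⊕-decomposable v v∉ i≢i₀ u<v v<w u∈ w∈))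

  block-read : ∃ λ k → InBlock πs i (p k)
  block-read = position d , subst (InBlock πs i) (sym (p∘position d)) (InBlock-column (X-column 0<L) 0<L)
    where
    0<L = proj₂ (proj₁ τ-indecomposable)
    d = column 0 0<L

lemmaB5 : (π : List ℕ) (πs : List (List ℕ)) →
    2 ≤ length πs → All ⊕-Indecomposable πs → π ≡ ⊕[ πs ] →
    (p : Diagram.Sequence π) → Diagram.IsPinRepresentation π p →
    (i₀ : Fin (length πs)) →
    (∀ (k : Fin (length π)) → toℕ k ≡ 0 → InBlock πs i₀ (p k)) →
    ∀ (i : Fin (length πs)) → i ≢ i₀ →
    Diagram.ReadInOnePiece π p (InBlock πs i)
lemmaB5 .(⊕[ πs ]) πs _ indecomposable refl p pin i₀ first∈i₀ i i≢i₀ =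
  Geometry.convex⇒ReadInOnePiece ⊕[ πs ] p (block-convex indecomposable pin first∈i₀ i≢i₀)
    (Blocks.Block.InBlock? πs i) (block-read indecomposable pin first∈i₀)
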